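{- Every substitution basis for the class of elementary functions is a basis for punctual standardness. That is, if $B$ is a finite set of elementary functions from which every elementary function can be obtained by substitution (composition) together with projections and constants, then every copy $\mathcal{A}$ of $(\mathbb{N},S)$ on which all functions in $B$ are primitive recursive is punctually standard.
   Context: The elementary functions are those in Kalmár's class of elementary functions (equivalently, the Grzegorczyk class $\mathcal{E}^3$). A copy of $\mathcal{S}=(\mathbb{N},S)$ ($S$ the successor) is a structure $\mathcal{A}=(\mathbb{N},S^{\mathcal{A}})$ isomorphic to $(\mathbb{N},S)$ via an isomorphism $c$. For $f:\mathbb{N}^k\to\mathbb{N}$, $f^{\mathcal{A}}(x_1,\dots,x_k)=c(f(c^{ -1}(x_1),\dots,c^{ -1}(x_k)))$, and $f$ is primitive recursive on $\mathcal{A}$ if $f^{\mathcal{A}}$ is primitive recursive. $\mathcal{A}$ is punctually standard if the class of functions primitive recursive on $\mathcal{A}$ equals the class of primitive recursive functions. A class $\mathcal{F}$ of primitive recursive functions is a basis for punctual standardness if for every copy $\mathcal{A}$ of $\mathcal{S}$, if all members of $\mathcal{F}$ are primitive recursive on $\mathcal{A}$ then $\mathcal{A}$ is punctually standard. -}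

module Defs where

open import Data.Nat using (ℕ; zero; suc; _+_; _*_; _∸_)
open import Data.Fin using (Fin)
open import Data.Vec using (Vec; []; _∷_; lookup; tabulate; map)
open import Data.Product using (Σ; ∃; _×_; _,_)
open import Relation.Binary.PropositionalEquality using (_≡_)
open import Function.Bundles using (_⇔_)

Fun : ℕ → Set
Fun k = Vec ℕ k → ℕ

data PR : ℕ → Set where
  zeroᵖ : ∀ {k} → PR k
  succᵖ : PR 1
  projᵖ : ∀ {k} → Fin k → PR k
  compᵖ : ∀ {m k} → PR m → (Fin m → PR k) → PR k
  recᵖ  : ∀ {k} → PR k → PR (suc (suc k)) → PR (suc k)

primRec : ∀ {k} → Fun k → Fun (suc (suc k)) → ℕ → Fun k
primRec f g zero    xs = f xs
primRec f g (suc n) xs = g (n ∷ primRec f g n xs ∷ xs)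

⟦_⟧ᵖ : ∀ {k} → PR k → Fun k
⟦ zeroᵖ ⟧ᵖ xs = 0
⟦ succᵖ ⟧ᵖ (x ∷ []) = suc x
⟦ projᵖ i ⟧ᵖ xs = lookup xs i
⟦ compᵖ h gs ⟧ᵖ xs = ⟦ h ⟧ᵖ (tabulate (λ i → ⟦ gs i ⟧ᵖ xs))
⟦ recᵖ f g ⟧ᵖ (n ∷ xs) = primRec ⟦ f ⟧ᵖ ⟦ g ⟧ᵖ n xs

IsPrimRec : ∀ {k} → Fun k → Set
IsPrimRec {k} f = Σ (PR k) λ p → ∀ xs → ⟦ p ⟧ᵖ xs ≡ f xs

data El : ℕ → Set where
  zeroᵉ  : ∀ {k} → El k
  succᵉ  : El 1
  projᵉ  : ∀ {k} → Fin k → El k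
  addᵉ   : El 2
  monusᵉ : El 2
  compᵉ  : ∀ {m k} → El m → (Fin m → El k) → El k
  bsumᵉ  : ∀ {k} → El (suc k) → El (suc k)
  bprodᵉ : ∀ {k} → El (suc k) → El (suc k)

boundedSum : ∀ {k} → Fun (suc k) → ℕ → Vec ℕ k → ℕ
boundedSum f zero    xs = 0
boundedSum f (suc z) xs = boundedSum f z xs + f (z ∷ xs)

boundedProd : ∀ {k} → Fun (suc k) → ℕ → Vec ℕ k → ℕ
boundedProd f zero    xs = 1
boundedProd f (suc z) xs = boundedProd f z xs * f (z ∷ xs)

⟦_⟧ᵉ : ∀ {k} → El k → Fun k
⟦ zeroᵉ ⟧ᵉ xs = 0
⟦ succᵉ ⟧ᵉ (x ∷ []) = suc x
⟦ projᵉ i ⟧ᵉ xs = lookup xs i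
⟦ addᵉ ⟧ᵉ (x ∷ y ∷ []) = x + y
⟦ monusᵉ ⟧ᵉ (x ∷ y ∷ []) = x ∸ y
⟦ compᵉ h gs ⟧ᵉ xs = ⟦ h ⟧ᵉ (tabulate (λ i → ⟦ gs i ⟧ᵉ xs))
⟦ bsumᵉ f ⟧ᵉ (z ∷ xs) = boundedSum ⟦ f ⟧ᵉ z xs
⟦ bprodᵉ f ⟧ᵉ (z ∷ xs) = boundedProd ⟦ f ⟧ᵉ z xs

IsElementary : ∀ {k} → Fun k → Set
IsElementary {k} f = Σ (El k) λ e → ∀ xs → ⟦ e ⟧ᵉ xs ≡ f xs

record FinFunSet : Set₁ where
  field
    size  : ℕ
    arity : Fin size → ℕ
    fun   : (i : Fin size) → Fun (arity i)
open FinFunSet public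

data SubstTerm (B : FinFunSet) (k : ℕ) : Set where
  var   : Fin k → SubstTerm B k
  const : ℕ → SubstTerm B k
  app   : (i : Fin (size B)) → (Fin (arity B i) → SubstTerm B k) → SubstTerm B k

⟦_⟧ˢ : ∀ {B k} → SubstTerm B k → Fun k
⟦ var i ⟧ˢ xs = lookup xs i
⟦ const c ⟧ˢ xs = c
⟦_⟧ˢ {B} (app i ts) xs = fun B i (tabulate (λ j → ⟦ ts j ⟧ˢ xs))

ObtainableBySubst : (B : FinFunSet) → ∀ {k} → Fun k → Set
ObtainableBySubst B {k} f = Σ (SubstTerm B k) λ t → ∀ xs → ⟦ t ⟧ˢ xs ≡ f xs

IsSubstBasisElem : FinFunSet → Set
IsSubstBasisElem B =
  (∀ i → IsElementary (fun B i)) ×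
  (∀ k (f : Fun k) → IsElementary f → ObtainableBySubst B f)

-- Copies of (ℕ, S): a successor function sA together with an
-- isomorphism c : (ℕ, suc) ≅ (ℕ, sA) (c bijective with inverse c⁻¹).

record CopyOfS : Set where
  field
    sA     : ℕ → ℕ
    c      : ℕ → ℕ
    c⁻¹    : ℕ → ℕ
    c∘c⁻¹  : ∀ x → c (c⁻¹ x) ≡ x
    c⁻¹∘c  : ∀ x → c⁻¹ (c x) ≡ x
    c-hom  : ∀ x → c (suc x) ≡ sA (c x)
open CopyOfS public

_^_ : ∀ {k} → Fun k → CopyOfS → Fun k
(f ^ A) xs = c A (f (map (c⁻¹ A) xs))

PrimRecOn : CopyOfS → ∀ {k} → Fun k → Set
PrimRecOn A f = IsPrimRec (f ^ A)

PunctuallyStandard : CopyOfS → Set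
PunctuallyStandard A = ∀ k (f : Fun k) → PrimRecOn A f ⇔ IsPrimRec f

BasisForPunctualStandardness : FinFunSet → Set
BasisForPunctualStandardness F =
  ∀ (A : CopyOfS) → (∀ i → PrimRecOn A (fun F i)) → PunctuallyStandard A

-- The successor is elementary, hence primitive recursive on A; so sA is primitive recursive, and
-- so is c, obtained from it by recursion. Conjugation by c and c⁻¹ transfers primitive
-- recursiveness in both directions, so it remains to show that c⁻¹ is primitive recursive.
-- Fix a program for c. Running it with a clock t is elementary (a recursion is evaluated by
-- searching for its history among the numbers below (1 + t) ^ (1 + n)), and a run either fails or
-- is correct. Let best n be the m ≤ n whose run with clock n returns the largest value. As c is
-- injective, either all runs for m ≤ n succeed and n ≤ c (best n), or the first failing m is at
-- most 1 + c (best n) and n is below the clock that m needs. Since best is elementary,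
-- x ↦ c (best (c⁻¹ x)) is primitive recursive; this bounds c⁻¹, which is then found by bounded
-- search.
module Submission where

open import Defs
open import Data.Nat
  using (ℕ; zero; suc; _+_; _*_; _∸_; _≤_; _<_; z≤n; s≤s; z<s; s≤s⁻¹; pred; NonZero; _/_; _%_; _≟_; _≤?_)
  renaming (_^_ to _^ℕ_)
open import Data.Nat.Properties
open import Data.Nat.DivMod hiding (_div_)
open import Data.Fin using (Fin; zero; suc; toℕ; fromℕ<)
open import Data.Fin.Properties using (pigeonhole; toℕ-fromℕ<; toℕ<n)
open import Data.Vec using (Vec; []; _∷_; lookup; tabulate; map; head; tail)
open import Data.Vec.Properties
  using (tabulate∘lookup; lookup∘tabulate; tabulate-cong; lookup-map; tabulate-∘; map-∘; map-cong; map-id)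
open import Data.List using (upTo)
open import Data.List.Extrema ≤-totalOrder using (argmax; argmax-sel; f[xs]≤f[argmax])
open import Data.List.Membership.Propositional.Properties using (∈-upTo⁺; ∈-upTo⁻)
import Data.List.Relation.Unary.All as All
open import Data.Product using (∃; _×_; _,_; proj₁; proj₂)
open import Data.Sum using (_⊎_; inj₁; inj₂; [_,_]′)
open import Data.Empty using (⊥-elim)
open import Function using (_∘_)
open import Function.Bundles using (mk⇔)
open import Relation.Nullary using (yes; no)
open import Relation.Binary.PropositionalEquality

∑< : (ℕ → ℕ) → ℕ → ℕ
∑< f zero    = 0
∑< f (suc n) = ∑< f n + f n

∏< : (ℕ → ℕ) → ℕ → ℕ
∏< f zero    = 1
∏< f (suc n) = ∏< f n * f n

∑<-cong : ∀ {f g} n → (∀ i → i < n → f i ≡ g i) → ∑< f n ≡ ∑< g n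
∑<-cong zero    f≗g = refl
∑<-cong (suc n) f≗g = cong₂ _+_ (∑<-cong n (λ i i<n → f≗g i (m<n⇒m<1+n i<n))) (f≗g n ≤-refl)

∏<-cong : ∀ {f g} n → (∀ i → i < n → f i ≡ g i) → ∏< f n ≡ ∏< g n
∏<-cong zero    f≗g = refl
∏<-cong (suc n) f≗g = cong₂ _*_ (∏<-cong n (λ i i<n → f≗g i (m<n⇒m<1+n i<n))) (f≗g n ≤-refl)

boundedSum≡∑< : ∀ {k} (f : Fun (suc k)) n xs → boundedSum f n xs ≡ ∑< (λ i → f (i ∷ xs)) n
boundedSum≡∑< f zero    xs = refl
boundedSum≡∑< f (suc n) xs = cong (_+ f (n ∷ xs)) (boundedSum≡∑< f n xs)

boundedProd≡∏< : ∀ {k} (f : Fun (suc k)) n xs → boundedProd f n xs ≡ ∏< (λ i → f (i ∷ xs)) n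
boundedProd≡∏< f zero    xs = refl
boundedProd≡∏< f (suc n) xs = cong (_* f (n ∷ xs)) (boundedProd≡∏< f n xs)

∑<-const : ∀ b n → ∑< (λ _ → b) n ≡ n * b
∑<-const b zero    = refl
∑<-const b (suc n) = trans (cong (_+ b) (∑<-const b n)) (+-comm (n * b) b)

∏<-const : ∀ b n → ∏< (λ _ → b) n ≡ b ^ℕ n
∏<-const b zero    = refl
∏<-const b (suc n) = trans (cong (_* b) (∏<-const b n)) (*-comm (b ^ℕ n) b)

∏<-ones : ∀ {f} n → (∀ i → i < n → f i ≡ 1) → ∏< f n ≡ 1
∏<-ones n f≡1 = trans (∏<-cong n f≡1) (trans (∏<-const 1 n) (^-zeroˡ n))

*-≢0 : ∀ a b → a * b ≢ 0 → a ≢ 0 × b ≢ 0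
*-≢0 a b ab≢0 = (λ a≡0 → ab≢0 (cong (_* b) a≡0)) ,
                (λ b≡0 → ab≢0 (trans (cong (a *_) b≡0) (*-zeroʳ a)))

∏<-≢0 : ∀ {f} n → ∏< f n ≢ 0 → ∀ i → i < n → f i ≢ 0
∏<-≢0 (suc n) ∏≢0 i i<1+n with m≤n⇒m<n∨m≡n (s≤s⁻¹ i<1+n)
... | inj₁ i<n  = ∏<-≢0 n (proj₁ (*-≢0 _ _ ∏≢0)) i i<n
... | inj₂ refl = proj₂ (*-≢0 (∏< _ n) _ ∏≢0)

term≤∑< : ∀ f {n} i → i < n → f i ≤ ∑< f n
term≤∑< f {suc n} i i<1+n with m≤n⇒m<n∨m≡n (s≤s⁻¹ i<1+n)
... | inj₁ i<n  = ≤-trans (term≤∑< f i i<n) (m≤m+n (∑< f n) (f n))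
... | inj₂ refl = m≤n+m (f i) (∑< f i)

∑<-≢0 : ∀ {f n} i → i < n → f i ≢ 0 → ∑< f n ≢ 0
∑<-≢0 {f} i i<n fi≢0 ∑≡0 = fi≢0 (n≤0⇒n≡0 (subst (f i ≤_) ∑≡0 (term≤∑< f i i<n)))

∑<-indicator : ∀ {f} D → (∀ i → i < D → f i ≡ 1) → (∀ i → D ≤ i → f i ≡ 0) →
               ∀ n → D ≤ n → ∑< f n ≡ D
∑<-indicator {f} D below above = go
  where
  initial : ∀ n → n ≤ D → ∑< f n ≡ n
  initial zero    _   = refl
  initial (suc n) n<D = trans (cong₂ _+_ (initial n (<⇒≤ n<D)) (below n n<D)) (+-comm n 1)
  go : ∀ n → D ≤ n → ∑< f n ≡ D
  go n D≤n with m≤n⇒m<n∨m≡n D≤n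
  ... | inj₂ refl = initial n ≤-refl
  go (suc n) _ | inj₁ D<1+n =
    trans (cong₂ _+_ (go n (s≤s⁻¹ D<1+n)) (above n (s≤s⁻¹ D<1+n))) (+-identityʳ D)

∑<-*-constOnSupport : ∀ (v w : ℕ → ℕ) c n → (∀ i → i < n → v i ≢ 0 → w i ≡ c)
                    → ∑< (λ i → v i * w i) n ≡ ∑< v n * c
∑<-*-constOnSupport v w c zero    _ = refl
∑<-*-constOnSupport v w c (suc n) w≡c =
  trans (cong₂ _+_ (∑<-*-constOnSupport v w c n (λ i i<n → w≡c i (m<n⇒m<1+n i<n))) last)
        (sym (*-distribʳ-+ c (∑< v n) (v n)))
  where
  last : v n * w n ≡ v n * c
  last with v n ≟ 0
  ... | yes vn≡0 = trans (cong (_* w n) vn≡0) (cong (_* c) (sym vn≡0))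
  ... | no  vn≢0 = cong (v n *_) (w≡c n ≤-refl vn≢0)

∑ᶠ : ∀ {m} → (Fin m → ℕ) → ℕ
∑ᶠ {zero}  f = 0
∑ᶠ {suc m} f = f zero + ∑ᶠ (f ∘ suc)

∏ᶠ : ∀ {m} → (Fin m → ℕ) → ℕ
∏ᶠ {zero}  f = 1
∏ᶠ {suc m} f = f zero * ∏ᶠ (f ∘ suc)

term≤∑ᶠ : ∀ {m} (f : Fin m → ℕ) j → f j ≤ ∑ᶠ f
term≤∑ᶠ f zero    = m≤m+n (f zero) _
term≤∑ᶠ f (suc j) = ≤-trans (term≤∑ᶠ (f ∘ suc) j) (m≤n+m _ (f zero))

∏ᶠ-≢0 : ∀ {m} (f : Fin m → ℕ) → ∏ᶠ f ≢ 0 → ∀ j → f j ≢ 0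
∏ᶠ-≢0 f ∏≢0 zero    = proj₁ (*-≢0 (f zero) _ ∏≢0)
∏ᶠ-≢0 f ∏≢0 (suc j) = ∏ᶠ-≢0 (f ∘ suc) (proj₂ (*-≢0 (f zero) _ ∏≢0)) j

∏ᶠ-ones : ∀ {m} (f : Fin m → ℕ) → (∀ j → f j ≡ 1) → ∏ᶠ f ≡ 1
∏ᶠ-ones {zero}  f f≡1 = refl
∏ᶠ-ones {suc m} f f≡1 = cong₂ _*_ (f≡1 zero) (∏ᶠ-ones (f ∘ suc) (f≡1 ∘ suc))

injective⇒≤ : ∀ {h : ℕ → ℕ} → (∀ {a b} → h a ≡ h b → a ≡ b) →
              ∀ n b → (∀ m → m < n → h m ≤ b) → n ≤ suc b
injective⇒≤ {h} h-inj n b h≤b with n ≤? suc b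
... | yes n≤1+b = n≤1+b
... | no  n≰1+b with pigeonhole (≰⇒> n≰1+b) (λ i → fromℕ< (s≤s (h≤b (toℕ i) (toℕ<n i))))
...   | i , j , i<j , hi≡hj =
  ⊥-elim (<-irrefl (h-inj (trans (sym (toℕ-fromℕ< _)) (trans (cong toℕ hi≡hj) (toℕ-fromℕ< _)))) i<j)

maximum-attained : ∀ (h : ℕ → ℕ) n → ∃ λ m → m ≤ n × (∀ i → i ≤ n → h i ≤ h m)
maximum-attained h n =
  m , m≤n , λ i i≤n → All.lookup (f[xs]≤f[argmax] {f = h} 0 (upTo (suc n))) (∈-upTo⁺ (s≤s i≤n))
  where
  m = argmax h 0 (upTo (suc n))
  m≤n : m ≤ n
  m≤n with argmax-sel h 0 (upTo (suc n))
  ... | inj₁ m≡0 = subst (_≤ n) (sym m≡0) z≤n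
  ... | inj₂ m∈  = s≤s⁻¹ (∈-upTo⁻ m∈)

χ≤ : ℕ → ℕ → ℕ
χ≤ x y = 1 ∸ (x ∸ y)

χ≡ : ℕ → ℕ → ℕ
χ≡ x y = χ≤ x y * χ≤ y x

sg : ℕ → ℕ
sg = χ≤ 1

χ≤-≤ : ∀ {x y} → x ≤ y → χ≤ x y ≡ 1
χ≤-≤ x≤y = cong (1 ∸_) (m≤n⇒m∸n≡0 x≤y)

χ≤-> : ∀ {x y} → y < x → χ≤ x y ≡ 0
χ≤-> y<x = m≤n⇒m∸n≡0 (m<n⇒0<n∸m y<x)

sg-suc : ∀ x → sg (suc x) ≡ 1
sg-suc x = χ≤-≤ {1} {suc x} (s≤s z≤n)

χ≤≢0⇒≤ : ∀ x y → χ≤ x y ≢ 0 → x ≤ y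
χ≤≢0⇒≤ x y χ≢0 with x ≤? y
... | yes x≤y = x≤y
... | no  x≰y = ⊥-elim (χ≢0 (χ≤-> (≰⇒> x≰y)))

χ≡-refl : ∀ x → χ≡ x x ≡ 1
χ≡-refl x = cong₂ _*_ (χ≤-≤ {x} ≤-refl) (χ≤-≤ {x} ≤-refl)

χ≡≢0⇒≡ : ∀ x y → χ≡ x y ≢ 0 → x ≡ y
χ≡≢0⇒≡ x y χ≢0 = ≤-antisym (χ≤≢0⇒≤ x y (proj₁ ≢0)) (χ≤≢0⇒≤ y x (proj₂ ≢0))
  where ≢0 = *-≢0 (χ≤ x y) (χ≤ y x) χ≢0

-- Division made total by x div 0 = x, the value of the counting formula in div≡count.
_div_ : ℕ → ℕ → ℕ
x div zero  = x
x div suc d = x / suc d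

div-nonZero : ∀ x d .{{_ : NonZero d}} → x div d ≡ x / d
div-nonZero x (suc d) = refl

*-div-cancelˡ : ∀ d w → d ≢ 0 → (d * w) div d ≡ w
*-div-cancelˡ zero    w d≢0 = ⊥-elim (d≢0 refl)
*-div-cancelˡ (suc d) w _   = trans (cong (_/ suc d) (*-comm (suc d) w)) (m*n/n≡m w (suc d))

div≡count : ∀ x d → x div d ≡ ∑< (λ q → χ≤ (suc q * d) x) x
div≡count x zero = sym (begin
  ∑< (λ q → χ≤ (suc q * 0) x) x ≡⟨ ∑<-cong x (λ q _ → χ≤-≤ (q*0≤x q)) ⟩
  ∑< (λ _ → 1) x                ≡⟨ trans (∑<-const 1 x) (*-identityʳ x) ⟩
  x                             ∎)
  where
  open ≡-Reasoning
  q*0≤x : ∀ q → suc q * 0 ≤ x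
  q*0≤x q = subst (_≤ x) (sym (*-zeroʳ (suc q))) z≤n
div≡count x (suc d) = sym (∑<-indicator (x / suc d) below above x (m/n≤m x (suc d)))
  where
  below : ∀ q → q < x / suc d → χ≤ (suc q * suc d) x ≡ 1
  below q q<x/d = χ≤-≤ (≤-trans (*-monoˡ-≤ (suc d) q<x/d) (m/n*n≤m x (suc d)))
  above : ∀ q → x / suc d ≤ q → χ≤ (suc q * suc d) x ≡ 0
  above q x/d≤q = χ≤-> {suc q * suc d} {x} (≰⇒> λ qd≤x → <⇒≱ (s≤s x/d≤q)
    (subst (_≤ x / suc d) (m*n/n≡m (suc q) (suc d)) (/-monoˡ-≤ (suc d) qd≤x)))

mean : (v w : ℕ → ℕ) → ℕ → ℕ
mean v w n = ∑< (λ i → v i * w i) n div ∑< v n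

mean≡0⊎constOnSupport : ∀ v w c n → (∀ i → i < n → v i ≢ 0 → w i ≡ c) →
                        mean v w n ≡ 0 ⊎ mean v w n ≡ c
mean≡0⊎constOnSupport v w c n w≡c with ∑< v n ≟ 0
... | yes ∑≡0 = inj₁ (begin
  ∑< (λ i → v i * w i) n div ∑< v n ≡⟨ cong₂ _div_ (∑<-*-constOnSupport v w c n w≡c) ∑≡0 ⟩
  ∑< v n * c div 0                  ≡⟨ cong (λ s → s * c) ∑≡0 ⟩
  0                                 ∎)
  where open ≡-Reasoning
... | no ∑≢0 = inj₂ (trans (cong (_div ∑< v n) (∑<-*-constOnSupport v w c n w≡c)) (*-div-cancelˡ _ c ∑≢0))

mean≡constOnSupport : ∀ v w c n → (∀ i → i < n → v i ≢ 0 → w i ≡ c)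
                    → ∀ i → i < n → v i ≢ 0 → mean v w n ≡ c
mean≡constOnSupport v w c n w≡c i i<n vi≢0 =
  trans (cong (_div ∑< v n) (∑<-*-constOnSupport v w c n w≡c)) (*-div-cancelˡ _ c (∑<-≢0 i i<n vi≢0))

≢0⇒≡suc-pred : ∀ {x} → x ≢ 0 → x ≡ suc (pred x)
≢0⇒≡suc-pred {zero}  x≢0 = ⊥-elim (x≢0 refl)
≢0⇒≡suc-pred {suc x} _   = refl

-- Base-(1 + b) digits

digit : ℕ → ℕ → ℕ → ℕ
digit b x zero    = x % suc b
digit b x (suc i) = digit b (x / suc b) i

undigits : ℕ → (ℕ → ℕ) → ℕ → ℕ
undigits b h zero    = 0
undigits b h (suc n) = h 0 + suc b * undigits b (h ∘ suc) n

[a+nx]%n≡a : ∀ b a x → a < suc b → (a + suc b * x) % suc b ≡ a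
[a+nx]%n≡a b a x a<1+b = begin
  (a + suc b * x) % suc b ≡⟨ %-congˡ (cong (a +_) (*-comm (suc b) x)) ⟩
  (a + x * suc b) % suc b ≡⟨ [m+kn]%n≡m%n a x (suc b) ⟩
  a % suc b               ≡⟨ m<n⇒m%n≡m a<1+b ⟩
  a                       ∎
  where open ≡-Reasoning

[a+nx]/n≡x : ∀ b a x → a < suc b → (a + suc b * x) / suc b ≡ x
[a+nx]/n≡x b a x a<1+b = begin
  (a + suc b * x) / suc b       ≡⟨ /-congˡ (cong (a +_) (*-comm (suc b) x)) ⟩
  (a + x * suc b) / suc b       ≡⟨ +-distrib-/ a (x * suc b) remainders<n ⟩
  a / suc b + x * suc b / suc b ≡⟨ cong₂ _+_ (m<n⇒m/n≡0 a<1+b) (m*n/n≡m x (suc b)) ⟩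
  x                             ∎
  where
  open ≡-Reasoning
  remainders<n : a % suc b + x * suc b % suc b < suc b
  remainders<n = subst₂ (λ r r′ → r + r′ < suc b) (sym (m<n⇒m%n≡m a<1+b)) (sym (m*n%n≡0 x (suc b)))
                   (subst (_< suc b) (sym (+-identityʳ a)) a<1+b)

digit-undigits : ∀ b h n → (∀ j → j < n → h j < suc b) → ∀ i → i < n → digit b (undigits b h n) i ≡ h i
digit-undigits b h (suc n) h<b zero _ = [a+nx]%n≡a b (h 0) (undigits b (h ∘ suc) n) (h<b 0 z<s)
digit-undigits b h (suc n) h<b (suc i) 1+i<1+n = begin
  digit b (undigits b h (suc n) / suc b) i        ≡⟨ cong (λ x → digit b x i)
                                                       ([a+nx]/n≡x b (h 0) (undigits b (h ∘ suc) n) (h<b 0 z<s)) ⟩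
  digit b (undigits b (h ∘ suc) n) i              ≡⟨ digit-undigits b (h ∘ suc) n h∘suc<b i (s≤s⁻¹ 1+i<1+n) ⟩
  h (suc i)                                       ∎
  where
  open ≡-Reasoning
  h∘suc<b : ∀ j → j < n → h (suc j) < suc b
  h∘suc<b j j<n = h<b (suc j) (s≤s j<n)

undigits< : ∀ b h n → (∀ j → j < n → h j < suc b) → undigits b h n < suc b ^ℕ n
undigits< b h zero    _   = z<s
undigits< b h (suc n) h<b = begin-strict
  h 0 + suc b * rest   <⟨ +-monoˡ-< (suc b * rest) (h<b 0 z<s) ⟩
  suc b + suc b * rest ≡⟨ sym (*-suc (suc b) rest) ⟩
  suc b * suc rest     ≤⟨ *-monoʳ-≤ (suc b) (undigits< b (h ∘ suc) n (λ j j<n → h<b (suc j) (s≤s j<n))) ⟩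
  suc b * suc b ^ℕ n   ∎
  where
  open ≤-Reasoning
  rest = undigits b (h ∘ suc) n

digit≡div-pow-% : ∀ b x i → digit b x i ≡ x div (suc b ^ℕ i) % suc b
digit≡div-pow-% b x zero    = cong (_% suc b) (sym (n/1≡n x))
digit≡div-pow-% b x (suc i) = begin
  digit b (x / suc b) i                ≡⟨ digit≡div-pow-% b (x / suc b) i ⟩
  (x / suc b) div (suc b ^ℕ i) % suc b ≡⟨ cong (_% suc b) shift ⟩
  x div (suc b ^ℕ suc i) % suc b       ∎
  where
  open ≡-Reasoning
  instance
    pow≢0 : NonZero (suc b ^ℕ i)
    pow≢0 = m^n≢0 (suc b) i
    pow′≢0 : NonZero (suc b * suc b ^ℕ i)
    pow′≢0 = m*n≢0 (suc b) (suc b ^ℕ i)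
  shift : (x / suc b) div (suc b ^ℕ i) ≡ x div (suc b * suc b ^ℕ i)
  shift = trans (div-nonZero _ (suc b ^ℕ i))
         (trans (m/n/o≡m/[n*o] x (suc b) (suc b ^ℕ i)) (sym (div-nonZero x (suc b * suc b ^ℕ i))))

-- Classes closed under substitution and under the Kalmár operations

FunClass : Set₁
FunClass = ∀ {k} → Fun k → Set

binary : (ℕ → ℕ → ℕ) → Fun 2
binary _∙_ (x ∷ y ∷ []) = x ∙ y

record IsSubstitutionClosed (C : FunClass) : Set₁ where
  field
    ext         : ∀ {k} {f g : Fun k} → (∀ xs → f xs ≡ g xs) → C f → C g
    zero-closed : ∀ {k} → C {k} (λ _ → 0)
    suc-closed₁ : C {1} (λ xs → suc (head xs))
    proj-closed : ∀ {k} (i : Fin k) → C (λ xs → lookup xs i)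
    comp-closed : ∀ {m k} {h : Fun m} {gs : Fin m → Fun k}
                → C h → (∀ j → C (gs j)) → C (λ xs → h (tabulate (λ j → gs j xs)))

module SubstitutionClosedProperties {C : FunClass} (isSubstitutionClosed : IsSubstitutionClosed C) where

  open IsSubstitutionClosed isSubstitutionClosed public

  ClosedMap : ∀ {k m} → (Vec ℕ k → Vec ℕ m) → Set
  ClosedMap σ = ∀ j → C (λ xs → lookup (σ xs) j)

  ∘-closed : ∀ {k m} {h : Fun m} {σ : Vec ℕ k → Vec ℕ m} → C h → ClosedMap σ → C (λ xs → h (σ xs))
  ∘-closed {h = h} {σ} Ch Cσ = ext (λ xs → cong h (tabulate∘lookup (σ xs))) (comp-closed Ch Cσ)

  []-map : ∀ {k} → ClosedMap {k} (λ _ → [])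
  []-map ()

  ∷-map : ∀ {k m} {f : Fun k} {σ : Vec ℕ k → Vec ℕ m} →
          C f → ClosedMap σ → ClosedMap (λ xs → f xs ∷ σ xs)
  ∷-map Cf Cσ zero    = Cf
  ∷-map Cf Cσ (suc j) = Cσ j

  id-map : ∀ {k} → ClosedMap {k} (λ xs → xs)
  id-map = proj-closed

  head-closed : ∀ {k} → C {suc k} head
  head-closed = ext (λ { (x ∷ xs) → refl }) (proj-closed zero)

  tabulate-map : ∀ {k m} {fs : Fin m → Fun k} →
                 (∀ j → C (fs j)) → ClosedMap (λ xs → tabulate (λ j → fs j xs))
  tabulate-map {fs = fs} Cfs j = ext (λ xs → sym (lookup∘tabulate (λ j → fs j xs) j)) (Cfs j)

  tail-map : ∀ {k} → ClosedMap {suc k} tail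
  tail-map j = ext (λ { (x ∷ xs) → refl }) (proj-closed (suc j))

  ∘-map : ∀ {k l m} {τ : Vec ℕ l → Vec ℕ m} {σ : Vec ℕ k → Vec ℕ l}
        → ClosedMap τ → ClosedMap σ → ClosedMap (λ xs → τ (σ xs))
  ∘-map Cτ Cσ j = ∘-closed (Cτ j) Cσ

  tail∘-map : ∀ {k m} {σ : Vec ℕ k → Vec ℕ (suc m)} → ClosedMap σ → ClosedMap (λ xs → tail (σ xs))
  tail∘-map {σ = σ} = ∘-map {τ = tail} {σ = σ} tail-map

  wk-closed : ∀ {k} {f : Fun k} → C f → C {suc k} (λ xs → f (tail xs))
  wk-closed Cf = ∘-closed Cf tail-map

  suc-closed : ∀ {k} {f : Fun k} → C f → C (λ xs → suc (f xs))
  suc-closed {f = f} Cf = ∘-closed {σ = λ xs → f xs ∷ []} suc-closed₁ (∷-map Cf []-map)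

  unary-closed : ∀ {k} {u : ℕ → ℕ} {f : Fun k} → C {1} (λ xs → u (head xs)) → C f → C (λ xs → u (f xs))
  unary-closed {f = f} Cu Cf = ∘-closed {σ = λ xs → f xs ∷ []} Cu (∷-map Cf []-map)

  map-closedMap : ∀ {k} {u : ℕ → ℕ} → C {1} (λ xs → u (head xs)) → ClosedMap {k} (map u)
  map-closedMap {u = u} Cu j = ext (λ xs → sym (lookup-map j u xs)) (unary-closed {u = u} Cu (proj-closed j))

  const-closed : ∀ {k} n → C {k} (λ _ → n)
  const-closed zero    = zero-closed
  const-closed (suc n) = suc-closed (const-closed n)

  binary-closed : ∀ {k} {_∙_ : ℕ → ℕ → ℕ} {f g : Fun k}
                → C (binary _∙_) → C f → C g → C (λ xs → f xs ∙ g xs)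
  binary-closed {f = f} {g} C∙ Cf Cg =
    ∘-closed {σ = λ xs → f xs ∷ g xs ∷ []} C∙ (∷-map Cf (∷-map Cg []-map))

record IsKalmarClosed (C : FunClass) : Set₁ where
  field
    isSubstitutionClosed : IsSubstitutionClosed C
    +-closed₂            : C (binary _+_)
    ∸-closed₂            : C (binary _∸_)
    boundedSum-closed    : ∀ {k} {f : Fun (suc k)} → C f → C (λ xs → boundedSum f (head xs) (tail xs))
    boundedProd-closed   : ∀ {k} {f : Fun (suc k)} → C f → C (λ xs → boundedProd f (head xs) (tail xs))

module KalmarProperties {C : FunClass} (isKalmarClosed : IsKalmarClosed C) where

  open IsKalmarClosed isKalmarClosed public
  open SubstitutionClosedProperties isSubstitutionClosed public

  +-closed : ∀ {k} {f g : Fun k} → C f → C g → C (λ xs → f xs + g xs)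
  +-closed = binary-closed +-closed₂

  ∸-closed : ∀ {k} {f g : Fun k} → C f → C g → C (λ xs → f xs ∸ g xs)
  ∸-closed = binary-closed ∸-closed₂

  ∑-closed : ∀ {k} {f : Fun (suc k)} {g : Fun k} → C f → C g → C (λ xs → ∑< (λ i → f (i ∷ xs)) (g xs))
  ∑-closed {f = f} {g = g} Cf Cg = ext (λ xs → boundedSum≡∑< f (g xs) xs)
    (∘-closed {σ = λ xs → g xs ∷ xs} (boundedSum-closed Cf) (∷-map Cg id-map))

  ∏-closed : ∀ {k} {f : Fun (suc k)} {g : Fun k} → C f → C g → C (λ xs → ∏< (λ i → f (i ∷ xs)) (g xs))
  ∏-closed {f = f} {g = g} Cf Cg = ext (λ xs → boundedProd≡∏< f (g xs) xs)
    (∘-closed {σ = λ xs → g xs ∷ xs} (boundedProd-closed Cf) (∷-map Cg id-map))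

  *-closed : ∀ {k} {f g : Fun k} → C f → C g → C (λ xs → f xs * g xs)
  *-closed {f = f} {g = g} Cf Cg = ext (λ xs → ∑<-const (g xs) (f xs)) (∑-closed (wk-closed Cg) Cf)

  ^-closed : ∀ {k} {f g : Fun k} → C f → C g → C (λ xs → f xs ^ℕ g xs)
  ^-closed {f = f} {g = g} Cf Cg = ext (λ xs → ∏<-const (f xs) (g xs)) (∏-closed (wk-closed Cf) Cg)

  pred-closed : ∀ {k} {f : Fun k} → C f → C (λ xs → pred (f xs))
  pred-closed {f = f} Cf = ext (λ xs → ∸1≡pred (f xs)) (∸-closed Cf (const-closed 1))
    where
    ∸1≡pred : ∀ x → x ∸ 1 ≡ pred x
    ∸1≡pred zero    = refl
    ∸1≡pred (suc x) = refl

  χ≤-closed : ∀ {k} {f g : Fun k} → C f → C g → C (λ xs → χ≤ (f xs) (g xs))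
  χ≤-closed Cf Cg = ∸-closed (const-closed 1) (∸-closed Cf Cg)

  χ≡-closed : ∀ {k} {f g : Fun k} → C f → C g → C (λ xs → χ≡ (f xs) (g xs))
  χ≡-closed Cf Cg = *-closed (χ≤-closed Cf Cg) (χ≤-closed Cg Cf)

  sg-closed : ∀ {k} {f : Fun k} → C f → C (λ xs → sg (f xs))
  sg-closed = χ≤-closed (const-closed 1)

  div-closed : ∀ {k} {f g : Fun k} → C f → C g → C (λ xs → f xs div g xs)
  div-closed {f = f} {g = g} Cf Cg = ext (λ xs → sym (div≡count (f xs) (g xs)))
    (∑-closed {f = λ ys → χ≤ (suc (lookup ys zero) * g (tail ys)) (f (tail ys))}
      (χ≤-closed (*-closed (suc-closed (proj-closed zero)) (wk-closed Cg)) (wk-closed Cf)) Cf)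

  mean-closed : ∀ {k} {v w : Fun (suc k)} {g : Fun k} → C v → C w → C g
              → C (λ xs → mean (λ i → v (i ∷ xs)) (λ i → w (i ∷ xs)) (g xs))
  mean-closed Cv Cw Cg = div-closed (∑-closed (*-closed Cv Cw) Cg) (∑-closed Cv Cg)

  digit-closed : ∀ {k} {f g h : Fun k} → C f → C g → C h → C (λ xs → digit (f xs) (g xs) (h xs))
  digit-closed {f = b} {g = x} {h = i} Cb Cx Ci = ext digit≡
    (∸-closed Cq (*-closed (div-closed Cq (suc-closed Cb)) (suc-closed Cb)))
    where
    q = λ xs → x xs div (suc (b xs) ^ℕ i xs)
    Cq = div-closed Cx (^-closed (suc-closed Cb) Ci)
    digit≡ : ∀ xs → q xs ∸ q xs div suc (b xs) * suc (b xs) ≡ digit (b xs) (x xs) (i xs)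
    digit≡ xs = sym (trans (digit≡div-pow-% (b xs) (x xs) (i xs)) (m%n≡m∸m/n*n (q xs) (suc (b xs))))

  ∑ᶠ-closed : ∀ {k m} {fs : Fin m → Fun k} → (∀ j → C (fs j)) → C (λ xs → ∑ᶠ (λ j → fs j xs))
  ∑ᶠ-closed {m = zero}  Cfs = const-closed 0
  ∑ᶠ-closed {m = suc m} Cfs = +-closed (Cfs zero) (∑ᶠ-closed (Cfs ∘ suc))

  ∏ᶠ-closed : ∀ {k m} {fs : Fin m → Fun k} → (∀ j → C (fs j)) → C (λ xs → ∏ᶠ (λ j → fs j xs))
  ∏ᶠ-closed {m = zero}  Cfs = const-closed 1
  ∏ᶠ-closed {m = suc m} Cfs = *-closed (Cfs zero) (∏ᶠ-closed (Cfs ∘ suc))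

  -- The inverse is found by bounded search, written as a mean over the single point v x.
  inverse-closed : ∀ {u v b : ℕ → ℕ} → (∀ x → u (v x) ≡ x) → (∀ y → v (u y) ≡ y) → (∀ x → v x ≤ b x)
                 → C {1} (λ xs → u (head xs)) → C {1} (λ xs → b (head xs)) → C {1} (λ xs → v (head xs))
  inverse-closed {u} {v} {b} uv≡id vu≡id v≤b Cu Cb = ext (λ { (x ∷ []) → search x })
    (mean-closed {v = λ ys → χ≡ (u (head ys)) (lookup ys (suc zero))} {w = head}
      (χ≡-closed (unary-closed {u = u} Cu head-closed) (proj-closed (suc zero))) head-closed (suc-closed Cb))
    where
    search : ∀ x → mean (λ m → χ≡ (u m) x) (λ m → m) (suc (b x)) ≡ v x
    search x = mean≡constOnSupport _ _ (v x) (suc (b x))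
      (λ m _ χ≢0 → trans (sym (vu≡id m)) (cong v (χ≡≢0⇒≡ (u m) x χ≢0)))
      (v x) (s≤s (v≤b x))
      (λ χ≡0 → 0≢1+n (trans (sym χ≡0) (trans (cong (λ y → χ≡ y x) (uv≡id x)) (χ≡-refl x))))

elementary-isKalmarClosed : IsKalmarClosed IsElementary
elementary-isKalmarClosed = record
  { isSubstitutionClosed = record
    { ext         = λ { f≗g (e , ⟦e⟧≗f) → e , λ xs → trans (⟦e⟧≗f xs) (f≗g xs) }
    ; zero-closed = zeroᵉ , λ _ → refl
    ; suc-closed₁ = succᵉ , λ { (x ∷ []) → refl }
    ; proj-closed = λ i → projᵉ i , λ _ → refl
    ; comp-closed = λ { (e , ⟦e⟧≗h) Cgs → compᵉ e (proj₁ ∘ Cgs) ,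
        λ xs → trans (cong ⟦ e ⟧ᵉ (tabulate-cong (λ j → proj₂ (Cgs j) xs))) (⟦e⟧≗h _) }
    }
  ; +-closed₂            = addᵉ , λ { (x ∷ y ∷ []) → refl }
  ; ∸-closed₂            = monusᵉ , λ { (x ∷ y ∷ []) → refl }
  ; boundedSum-closed    = λ { {f = f} (e , ⟦e⟧≗f) → bsumᵉ e ,
      λ { (n ∷ xs) → trans (boundedSum≡∑< ⟦ e ⟧ᵉ n xs)
                    (trans (∑<-cong n (λ i _ → ⟦e⟧≗f (i ∷ xs))) (sym (boundedSum≡∑< f n xs))) } }
  ; boundedProd-closed   = λ { {f = f} (e , ⟦e⟧≗f) → bprodᵉ e ,
      λ { (n ∷ xs) → trans (boundedProd≡∏< ⟦ e ⟧ᵉ n xs)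
                    (trans (∏<-cong n (λ i _ → ⟦e⟧≗f (i ∷ xs))) (sym (boundedProd≡∏< f n xs))) } }
  }

primRec-isSubstitutionClosed : IsSubstitutionClosed IsPrimRec
primRec-isSubstitutionClosed = record
  { ext         = λ { f≗g (p , ⟦p⟧≗f) → p , λ xs → trans (⟦p⟧≗f xs) (f≗g xs) }
  ; zero-closed = zeroᵖ , λ _ → refl
  ; suc-closed₁ = succᵖ , λ { (x ∷ []) → refl }
  ; proj-closed = λ i → projᵖ i , λ _ → refl
  ; comp-closed = λ { (p , ⟦p⟧≗h) Cgs → compᵖ p (proj₁ ∘ Cgs) ,
      λ xs → trans (cong ⟦ p ⟧ᵖ (tabulate-cong (λ j → proj₂ (Cgs j) xs))) (⟦p⟧≗h _) }
  }

module _ where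

  open SubstitutionClosedProperties primRec-isSubstitutionClosed

  recursion-closed : ∀ {k} {b : Fun k} {_∙_ : ℕ → ℕ → ℕ} {f : Fun (suc k)} {F : ℕ → Vec ℕ k → ℕ}
                   → IsPrimRec b → IsPrimRec (binary _∙_) → IsPrimRec f
                   → (∀ xs → F 0 xs ≡ b xs) → (∀ n xs → F (suc n) xs ≡ F n xs ∙ f (n ∷ xs))
                   → IsPrimRec (λ xs → F (head xs) (tail xs))
  recursion-closed {k} {b} {_∙_} {f} {F} (pb , ⟦pb⟧≗b) P∙ Pf base step =
    recᵖ pb (proj₁ Pg) , λ { (n ∷ xs) → agree n xs }
    where
    g : Fun (suc (suc k))
    g ys = lookup ys (suc zero) ∙ f (lookup ys zero ∷ tail (tail ys))
    Pg : IsPrimRec g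
    Pg = binary-closed P∙ (proj-closed (suc zero))
           (∘-closed {σ = λ ys → lookup ys zero ∷ tail (tail ys)} Pf
             (∷-map (proj-closed zero) (tail∘-map {σ = tail} tail-map)))
    agree : ∀ n xs → primRec ⟦ pb ⟧ᵖ ⟦ proj₁ Pg ⟧ᵖ n xs ≡ F n xs
    agree zero    xs = trans (⟦pb⟧≗b xs) (sym (base xs))
    agree (suc n) xs = trans (proj₂ Pg (n ∷ primRec ⟦ pb ⟧ᵖ ⟦ proj₁ Pg ⟧ᵖ n xs ∷ xs))
                             (trans (cong (_∙ f (n ∷ xs)) (agree n xs)) (sym (step n xs)))

  primRec-isKalmarClosed : IsKalmarClosed IsPrimRec
  primRec-isKalmarClosed = record
    { isSubstitutionClosed = primRec-isSubstitutionClosed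
    ; +-closed₂            = +-primRec
    ; ∸-closed₂            = ∸-primRec
    ; boundedSum-closed    = λ {_} {f} Pf → recursion-closed {_∙_ = _+_} {F = boundedSum f}
                               (const-closed 0) +-primRec Pf (λ _ → refl) (λ _ _ → refl)
    ; boundedProd-closed   = λ {_} {f} Pf → recursion-closed {_∙_ = _*_} {F = boundedProd f}
                               (const-closed 1) *-primRec Pf (λ _ → refl) (λ _ _ → refl)
    }
    where
    +-primRec : IsPrimRec (binary _+_)
    +-primRec = ext (λ { (x ∷ y ∷ []) → refl })
      (recursion-closed {F = λ x ys → x + head ys} head-closed
        (ext (λ { (a ∷ _ ∷ []) → refl }) (suc-closed (proj-closed zero))) (const-closed 0)
        (λ _ → refl) (λ _ _ → refl))
    pred-primRec : IsPrimRec {1} (λ xs → pred (head xs))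
    pred-primRec = recursion-closed {F = λ n _ → pred n} (const-closed 0)
      (ext (λ { (_ ∷ c ∷ []) → refl }) (proj-closed (suc zero))) (proj-closed zero)
      (λ _ → refl) (λ _ _ → refl)
    ∸-primRec : IsPrimRec (binary _∸_)
    ∸-primRec = ext (λ { (x ∷ y ∷ []) → refl })
      (∘-closed {σ = λ xs → lookup xs (suc zero) ∷ lookup xs zero ∷ []}
        (recursion-closed {F = λ y xs → head xs ∸ y} head-closed
          (ext (λ { (a ∷ _ ∷ []) → refl }) (unary-closed {u = pred} pred-primRec (proj-closed zero)))
          (const-closed 0) (λ _ → refl) (λ n xs → sym (pred[m∸n]≡m∸[1+n] (head xs) n)))
        (∷-map (proj-closed (suc zero)) (∷-map (proj-closed zero) []-map)))
    *-primRec : IsPrimRec (binary _*_)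
    *-primRec = ext (λ { (x ∷ y ∷ []) → refl })
      (recursion-closed {F = λ x ys → x * lookup ys zero} (const-closed 0) +-primRec (proj-closed (suc zero))
        (λ _ → refl) (λ n ys → +-comm (lookup ys zero) (n * lookup ys zero)))

module E = KalmarProperties elementary-isKalmarClosed
module P = KalmarProperties primRec-isKalmarClosed

-- Clocked evaluation of primitive recursive programs

Approximates : ∀ {k} → Fun k → Fun k → Set
Approximates c F = ∀ xs v → c xs ≡ suc v → v ≡ F xs

-- Recognises the codes whose base-(1 + t) digits 0, …, n form a computation history of
-- primRec, each step checked by the approximations cf and cg.
isHistory : ∀ {k} → Fun k → Fun (suc (suc k)) → ℕ → ℕ → Vec ℕ k → ℕ → ℕ
isHistory cf cg t n xs code =
  χ≡ (cf xs) (suc (digit t code 0)) *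
  ∏< (λ i → χ≡ (cg (i ∷ digit t code i ∷ xs)) (suc (digit t code (suc i)))) n

clockedRec : ∀ {k} → Fun k → Fun (suc (suc k)) → ℕ → ℕ → Vec ℕ k → ℕ
clockedRec cf cg t n xs = mean (isHistory cf cg t n xs) (λ code → suc (digit t code n)) (suc t ^ℕ suc n)

module _ {k} {F : Fun k} {G : Fun (suc (suc k))} {cf : Fun k} {cg : Fun (suc (suc k))}
         (cf≈F : Approximates cf F) (cg≈G : Approximates cg G) (t : ℕ) where

  isHistory⇒digits : ∀ n xs code → isHistory cf cg t n xs code ≢ 0 →
                     ∀ i → i ≤ n → digit t code i ≡ primRec F G i xs
  isHistory⇒digits n xs code accepted = go
    where
    accepted′ = *-≢0 (χ≡ (cf xs) (suc (digit t code 0))) _ accepted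
    go : ∀ i → i ≤ n → digit t code i ≡ primRec F G i xs
    go zero    _     = cf≈F xs _ (χ≡≢0⇒≡ _ _ (proj₁ accepted′))
    go (suc i) 1+i≤n = trans
      (cg≈G _ _ (χ≡≢0⇒≡ _ _ (∏<-≢0 n (proj₂ accepted′) i 1+i≤n)))
      (cong (λ v → G (i ∷ v ∷ xs)) (go i (<⇒≤ 1+i≤n)))

  clockedRec-approximates : ∀ n xs v → clockedRec cf cg t n xs ≡ suc v → v ≡ primRec F G n xs
  clockedRec-approximates n xs v rec≡1+v
    with mean≡0⊎constOnSupport (isHistory cf cg t n xs) (λ code → suc (digit t code n))
           (suc (primRec F G n xs)) (suc t ^ℕ suc n)
           (λ code _ accepted → cong suc (isHistory⇒digits n xs code accepted n ≤-refl))
  ... | inj₁ rec≡0 = ⊥-elim (0≢1+n (trans (sym rec≡0) rec≡1+v))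
  ... | inj₂ rec≡H = suc-injective (trans (sym rec≡1+v) rec≡H)

  clockedRec-correct : ∀ n xs → (∀ i → i ≤ n → primRec F G i xs < suc t) →
                       cf xs ≡ suc (F xs) →
                       (∀ i → i < n → cg (i ∷ primRec F G i xs ∷ xs) ≡ suc (primRec F G (suc i) xs)) →
                       clockedRec cf cg t n xs ≡ suc (primRec F G n xs)
  clockedRec-correct n xs H≤t cf≡F cg≡G =
    mean≡constOnSupport (isHistory cf cg t n xs) (λ code → suc (digit t code n)) _ (suc t ^ℕ suc n)
      (λ code _ accepted → cong suc (isHistory⇒digits n xs code accepted n ≤-refl))
      history (undigits< t H (suc n) H<) (λ accepted≡0 → 0≢1+n (trans (sym accepted≡0) accepted))
    where
    H = λ i → primRec F G i xs
    H< : ∀ i → i < suc n → H i < suc t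
    H< i i<1+n = H≤t i (s≤s⁻¹ i<1+n)
    history = undigits t H (suc n)
    digit≡H : ∀ i → i ≤ n → digit t history i ≡ H i
    digit≡H i i≤n = digit-undigits t H (suc n) H< i (s≤s i≤n)
    accepted : isHistory cf cg t n xs history ≡ 1
    accepted = cong₂ _*_
      (trans (cong₂ χ≡ cf≡F (cong suc (digit≡H 0 z≤n))) (χ≡-refl (suc (H 0))))
      (∏<-ones n λ i i<n → trans
        (cong₂ χ≡ (trans (cong (λ v → cg (i ∷ v ∷ xs)) (digit≡H i (<⇒≤ i<n))) (cg≡G i i<n))
                  (cong suc (digit≡H (suc i) i<n)))
        (χ≡-refl (suc (H (suc i)))))

-- Evaluation within clock t: 0 signals failure and 1 + v the value v.
clocked : ∀ {k} → PR k → ℕ → Fun k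
clocked zeroᵖ        t xs       = 1
clocked succᵖ        t (x ∷ []) = suc (suc x)
clocked (projᵖ i)    t xs       = suc (lookup xs i)
clocked (compᵖ h gs) t xs       =
  ∏ᶠ (λ j → sg (clocked (gs j) t xs)) * clocked h t (tabulate (λ j → pred (clocked (gs j) t xs)))
clocked (recᵖ f g)   t (n ∷ xs) = clockedRec (clocked f t) (clocked g t) t n xs

clockBound : ∀ {k} → PR k → Fun k
clockBound zeroᵖ        xs       = 0
clockBound succᵖ        xs       = 0
clockBound (projᵖ i)    xs       = 0
clockBound (compᵖ h gs) xs       =
  clockBound h (tabulate (λ j → ⟦ gs j ⟧ᵖ xs)) + ∑ᶠ (λ j → clockBound (gs j) xs)
clockBound (recᵖ f g)   (n ∷ xs) =
  clockBound f xs +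
  ∑< (λ i → clockBound g (i ∷ ⟦ recᵖ f g ⟧ᵖ (i ∷ xs) ∷ xs) + ⟦ recᵖ f g ⟧ᵖ (i ∷ xs)) (suc n)

clocked-approximates : ∀ {k} (p : PR k) t → Approximates (clocked p t) ⟦ p ⟧ᵖ
clocked-approximates zeroᵖ        t xs       v c≡1+v = sym (suc-injective c≡1+v)
clocked-approximates succᵖ        t (x ∷ []) v c≡1+v = sym (suc-injective c≡1+v)
clocked-approximates (projᵖ i)    t xs       v c≡1+v = sym (suc-injective c≡1+v)
clocked-approximates (compᵖ h gs) t xs       v c≡1+v =
  trans (clocked-approximates h t _ v h≡1+v) (cong ⟦ h ⟧ᵖ (tabulate-cong args≡))
  where
  guard = ∏ᶠ (λ j → sg (clocked (gs j) t xs))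
  hval  = clocked h t (tabulate (λ j → pred (clocked (gs j) t xs)))
  nonzero = *-≢0 guard hval (λ c≡0 → 0≢1+n (trans (sym c≡0) c≡1+v))
  gs≢0 : ∀ j → clocked (gs j) t xs ≢ 0
  gs≢0 j gs≡0 = ∏ᶠ-≢0 _ (proj₁ nonzero) j (cong sg gs≡0)
  guard≡1 : guard ≡ 1
  guard≡1 = ∏ᶠ-ones _ (λ j → χ≤-≤ (n≢0⇒n>0 (gs≢0 j)))
  h≡1+v : hval ≡ suc v
  h≡1+v = trans (sym (*-identityˡ hval)) (trans (cong (_* hval) (sym guard≡1)) c≡1+v)
  args≡ : ∀ j → pred (clocked (gs j) t xs) ≡ ⟦ gs j ⟧ᵖ xs
  args≡ j = clocked-approximates (gs j) t xs _ (≢0⇒≡suc-pred (gs≢0 j))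
clocked-approximates (recᵖ f g)   t (n ∷ xs) v c≡1+v =
  clockedRec-approximates (clocked-approximates f t) (clocked-approximates g t) t n xs v c≡1+v

clocked-correct : ∀ {k} (p : PR k) t xs → clockBound p xs ≤ t → clocked p t xs ≡ suc (⟦ p ⟧ᵖ xs)
clocked-correct zeroᵖ        t xs       _ = refl
clocked-correct succᵖ        t (x ∷ []) _ = refl
clocked-correct (projᵖ i)    t xs       _ = refl
clocked-correct (compᵖ h gs) t xs       clock≤t = begin
  ∏ᶠ (λ j → sg (clocked (gs j) t xs)) * clocked h t (tabulate (λ j → pred (clocked (gs j) t xs)))
    ≡⟨ cong₂ _*_ (∏ᶠ-ones _ (λ j → trans (cong sg (gs≡ j)) (sg-suc (⟦ gs j ⟧ᵖ xs))))
                 (cong (clocked h t) (tabulate-cong (λ j → cong pred (gs≡ j)))) ⟩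
  1 * clocked h t (tabulate (λ j → ⟦ gs j ⟧ᵖ xs))
    ≡⟨ *-identityˡ _ ⟩
  clocked h t (tabulate (λ j → ⟦ gs j ⟧ᵖ xs))
    ≡⟨ clocked-correct h t _ (≤-trans (m≤m+n _ _) clock≤t) ⟩
  suc (⟦ h ⟧ᵖ (tabulate (λ j → ⟦ gs j ⟧ᵖ xs)))
    ∎
  where
  open ≡-Reasoning
  gs≡ : ∀ j → clocked (gs j) t xs ≡ suc (⟦ gs j ⟧ᵖ xs)
  gs≡ j = clocked-correct (gs j) t xs
    (≤-trans (term≤∑ᶠ (λ j → clockBound (gs j) xs) j) (≤-trans (m≤n+m _ _) clock≤t))
clocked-correct (recᵖ f g)   t (n ∷ xs) clock≤t =
  clockedRec-correct (clocked-approximates f t) (clocked-approximates g t) t n xs H<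
    (clocked-correct f t xs (≤-trans (m≤m+n _ _) clock≤t))
    (λ i i<n → clocked-correct g t _ (≤-trans (m≤m+n _ _) (step≤t i (<⇒≤ i<n))))
  where
  H = λ i → ⟦ recᵖ f g ⟧ᵖ (i ∷ xs)
  step = λ i → clockBound g (i ∷ H i ∷ xs) + H i
  step≤t : ∀ i → i ≤ n → step i ≤ t
  step≤t i i≤n = ≤-trans (term≤∑< step i (s≤s i≤n)) (≤-trans (m≤n+m _ (clockBound f xs)) clock≤t)
  H< : ∀ i → i ≤ n → H i < suc t
  H< i i≤n = s≤s (≤-trans (m≤n+m (H i) _) (step≤t i i≤n))

clockedRec-elementary : ∀ {k} {cf : ℕ → Fun k} {cg : ℕ → Fun (suc (suc k))}
  → IsElementary (λ ys → cf (head ys) (tail ys)) → IsElementary (λ ys → cg (head ys) (tail ys))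
  → IsElementary (λ ys → clockedRec (cf (head ys)) (cg (head ys)) (head ys) (head (tail ys)) (tail (tail ys)))
clockedRec-elementary {k} {cf} {cg} Ecf Ecg =
  ext (λ { (t ∷ n ∷ xs) → refl })
    (mean-closed {v = accepts} {w = λ zs → suc (digit (clk zs) (code zs) (len zs))}
      (*-closed (χ≡-closed (∘-closed {σ = λ zs → clk zs ∷ args zs} Ecf (∷-map Eclk Eargs))
                           (suc-closed (digit-closed Eclk Ecode (const-closed 0))))
                (∏-closed {f = λ ws → link (tail ws) (head ws)} Elink Elen))
      (suc-closed (digit-closed Eclk Ecode Elen))
      (^-closed (suc-closed (proj-closed zero)) (suc-closed (proj-closed (suc zero)))))
  where
  open E
  code clk len : Vec ℕ (3 + k) → ℕ
  code zs = lookup zs zero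
  clk  zs = lookup zs (suc zero)
  len  zs = lookup zs (suc (suc zero))
  args : Vec ℕ (3 + k) → Vec ℕ k
  args zs = tail (tail (tail zs))
  accepts : Fun (3 + k)
  accepts zs = isHistory (cf (clk zs)) (cg (clk zs)) (clk zs) (len zs) (args zs) (code zs)
  link : Vec ℕ (3 + k) → ℕ → ℕ
  link zs i = χ≡ (cg (clk zs) (i ∷ digit (clk zs) (code zs) i ∷ args zs)) (suc (digit (clk zs) (code zs) (suc i)))
  Ecode = proj-closed {3 + k} zero
  Eclk  = proj-closed {3 + k} (suc zero)
  Elen  = proj-closed {3 + k} (suc (suc zero))
  Eargs : ClosedMap args
  Eargs = tail∘-map {σ = λ zs → tail (tail zs)} (tail∘-map {σ = tail} tail-map)
  Elink : IsElementary (λ ws → link (tail ws) (head ws))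
  Elink = χ≡-closed
    (∘-closed {σ = λ ws → clk (tail ws) ∷ head ws ∷ digit (clk (tail ws)) (code (tail ws)) (head ws) ∷
                          args (tail ws)} Ecg
      (∷-map (wk-closed Eclk) (∷-map head-closed (∷-map (digit-closed (wk-closed Eclk) (wk-closed Ecode) head-closed)
        (∘-map {τ = args} {σ = tail} Eargs tail-map)))))
    (suc-closed (digit-closed (wk-closed Eclk) (wk-closed Ecode) (suc-closed head-closed)))

clocked-elementary : ∀ {k} (p : PR k) → IsElementary (λ ys → clocked p (head ys) (tail ys))
clocked-elementary zeroᵖ        = const-closed 1
  where open E
clocked-elementary succᵖ        = ext (λ { (t ∷ x ∷ []) → refl }) (suc-closed (suc-closed (proj-closed (suc zero))))
  where open E
clocked-elementary (projᵖ i)    = ext (λ { (t ∷ xs) → refl }) (suc-closed (proj-closed (suc i)))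
  where open E
clocked-elementary (compᵖ h gs) =
  *-closed (∏ᶠ-closed (λ j → sg-closed (clocked-elementary (gs j))))
    (∘-closed {σ = λ ys → head ys ∷ tabulate (λ j → pred (clocked (gs j) (head ys) (tail ys)))}
      (clocked-elementary h)
      (∷-map head-closed (tabulate-map (λ j → pred-closed (clocked-elementary (gs j))))))
  where open E
clocked-elementary (recᵖ f g)   =
  ext (λ { (t ∷ n ∷ xs) → refl })
    (clockedRec-elementary {cf = clocked f} {cg = clocked g} (clocked-elementary f) (clocked-elementary g))
  where open E

⟦⟧ᵖ-primRec : ∀ {k} (p : PR k) → IsPrimRec ⟦ p ⟧ᵖ
⟦⟧ᵖ-primRec p = p , λ _ → refl

clockBound-primRec : ∀ {k} (p : PR k) → IsPrimRec (clockBound p)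
clockBound-primRec zeroᵖ        = P.const-closed 0
clockBound-primRec succᵖ        = P.const-closed 0
clockBound-primRec (projᵖ i)    = P.const-closed 0
clockBound-primRec (compᵖ h gs) =
  +-closed (∘-closed {σ = λ xs → tabulate (λ j → ⟦ gs j ⟧ᵖ xs)} (clockBound-primRec h)
                     (tabulate-map (⟦⟧ᵖ-primRec ∘ gs)))
           (∑ᶠ-closed (clockBound-primRec ∘ gs))
  where open P
clockBound-primRec {suc k} (recᵖ f g) =
  ext (λ { (n ∷ xs) → refl })
    (+-closed (wk-closed (clockBound-primRec f)) (∑-closed {f = step} Pstep (suc-closed head-closed)))
  where
  open P
  args : Vec ℕ (2 + k) → Vec ℕ k
  args ws = tail (tail ws)
  Pargs : ClosedMap args
  Pargs = tail∘-map {σ = tail} tail-map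
  value : Fun (2 + k)
  value ws = ⟦ recᵖ f g ⟧ᵖ (head ws ∷ args ws)
  Pvalue : IsPrimRec value
  Pvalue = ∘-closed {σ = λ ws → head ws ∷ args ws} (⟦⟧ᵖ-primRec (recᵖ f g)) (∷-map head-closed Pargs)
  step : Fun (2 + k)
  step ws = clockBound g (head ws ∷ value ws ∷ args ws) + value ws
  Pstep : IsPrimRec step
  Pstep = +-closed (∘-closed {σ = λ ws → head ws ∷ value ws ∷ args ws} (clockBound-primRec g)
                     (∷-map head-closed (∷-map Pvalue Pargs)))
                   Pvalue

-- Copies of (ℕ, S)

module _ (A : CopyOfS) where

  open P

  c-injective : ∀ {x y} → c A x ≡ c A y → x ≡ y
  c-injective {x} {y} cx≡cy = trans (sym (c⁻¹∘c A x)) (trans (cong (c⁻¹ A) cx≡cy) (c⁻¹∘c A y))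

  substTerm-primRecOn : ∀ {B} → (∀ i → PrimRecOn A (fun B i)) →
                        ∀ {k} (t : SubstTerm B k) → PrimRecOn A ⟦ t ⟧ˢ
  substTerm-primRecOn B-on (var i)    =
    ext (λ xs → sym (trans (cong (c A) (lookup-map i (c⁻¹ A) xs)) (c∘c⁻¹ A _))) (proj-closed i)
  substTerm-primRecOn B-on (const n)  = const-closed (c A n)
  substTerm-primRecOn {B} B-on (app i ts) =
    ext (λ xs → cong (c A ∘ fun B i) (trans (sym (tabulate-∘ (c⁻¹ A) (λ j → (⟦ ts j ⟧ˢ ^ A) xs)))
                                            (tabulate-cong (λ j → c⁻¹∘c A _))))
      (comp-closed (B-on i) (λ j → substTerm-primRecOn B-on (ts j)))

  obtainable-primRecOn : ∀ {B} → (∀ i → PrimRecOn A (fun B i)) →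
                         ∀ {k} {f : Fun k} → ObtainableBySubst B f → PrimRecOn A f
  obtainable-primRecOn B-on (t , ⟦t⟧≗f) =
    ext (λ xs → cong (c A) (⟦t⟧≗f (map (c⁻¹ A) xs))) (substTerm-primRecOn B-on t)

  sA-primRec : PrimRecOn A {1} (λ xs → suc (head xs)) → IsPrimRec {1} (λ xs → sA A (head xs))
  sA-primRec = ext λ { (x ∷ []) → trans (c-hom A (c⁻¹ A x)) (cong (sA A) (c∘c⁻¹ A x)) }

  c-primRec : IsPrimRec {1} (λ xs → sA A (head xs)) → IsPrimRec {1} (λ xs → c A (head xs))
  c-primRec PsA = recursion-closed {_∙_ = λ a _ → sA A a} {F = λ m _ → c A m} (const-closed (c A 0))
    (ext (λ { (a ∷ _ ∷ []) → refl }) (unary-closed {u = sA A} PsA (proj-closed zero))) (const-closed 0)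
    (λ _ → refl) (λ m _ → c-hom A m)

  punctuallyStandard : IsPrimRec {1} (λ xs → c A (head xs)) → IsPrimRec {1} (λ xs → c⁻¹ A (head xs)) →
                       PunctuallyStandard A
  punctuallyStandard Pc Pc⁻¹ k f = mk⇔ to from
    where
    c⁻¹∘c-map : ∀ xs → map (c⁻¹ A) (map (c A) xs) ≡ xs
    c⁻¹∘c-map xs = trans (sym (map-∘ (c⁻¹ A) (c A) xs)) (trans (map-cong (c⁻¹∘c A) xs) (map-id xs))
    to : IsPrimRec (f ^ A) → IsPrimRec f
    to PfA = ext (λ xs → trans (c⁻¹∘c A _) (cong f (c⁻¹∘c-map xs)))
      (unary-closed {u = c⁻¹ A} Pc⁻¹ (∘-closed {σ = map (c A)} PfA (map-closedMap Pc)))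
    from : IsPrimRec f → IsPrimRec (f ^ A)
    from Pf = unary-closed {u = c A} Pc (∘-closed {σ = map (c⁻¹ A)} Pf (map-closedMap Pc⁻¹))

module Inversion (A : CopyOfS) (Pc : IsPrimRec {1} (λ xs → c A (head xs)))
                 (elementaryOn : ∀ {k} {f : Fun k} → IsElementary f → PrimRecOn A f) where

  pc : PR 1
  pc = proj₁ Pc

  attempt : ℕ → ℕ → ℕ
  attempt t m = clocked pc t (m ∷ [])

  attempt-≢0 : ∀ {t m} → attempt t m ≢ 0 → attempt t m ≡ suc (c A m)
  attempt-≢0 {t} {m} a≢0 = trans (≢0⇒≡suc-pred a≢0)
    (cong suc (trans (clocked-approximates pc t (m ∷ []) _ (≢0⇒≡suc-pred a≢0)) (proj₂ Pc (m ∷ []))))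

  attempt-correct : ∀ {t m} → clockBound pc (m ∷ []) ≤ t → attempt t m ≡ suc (c A m)
  attempt-correct {t} {m} clock≤t = trans (clocked-correct pc t (m ∷ []) clock≤t) (cong suc (proj₂ Pc (m ∷ [])))

  attempt-elementary : ∀ {k} {f g : Fun k} → IsElementary f → IsElementary g →
                       IsElementary (λ xs → attempt (f xs) (g xs))
  attempt-elementary = binary-closed (ext (λ { (t ∷ m ∷ []) → refl }) (clocked-elementary pc))
    where open E

  -- best n is the m ≤ n maximising attempt n m, extracted as a mean: injectivity of c makes the
  -- maximiser unique.
  isBest : ℕ → ℕ → ℕ
  isBest n m = sg (attempt n m) * ∏< (λ m′ → χ≤ (attempt n m′) (attempt n m)) (suc n)

  best : ℕ → ℕ
  best n = mean (isBest n) (λ m → m) (suc n)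

  best-elementary : IsElementary {1} (λ xs → best (head xs))
  best-elementary = ext (λ { (n ∷ []) → refl })
    (mean-closed {v = λ ys → isBest (lookup ys (suc zero)) (lookup ys zero)} {w = head}
      (*-closed (sg-closed (attempt-elementary (proj-closed (suc zero)) (proj-closed zero)))
                (∏-closed {f = atMost} (χ≤-closed (attempt-elementary (proj-closed _) head-closed)
                                                  (attempt-elementary (proj-closed _) (proj-closed _)))
                          (suc-closed (proj-closed (suc zero)))))
      head-closed (suc-closed head-closed))
    where
    open E
    atMost : Fun 3
    atMost zs = χ≤ (attempt (lookup zs (suc (suc zero))) (head zs))
                   (attempt (lookup zs (suc (suc zero))) (lookup zs (suc zero)))

  best-max : ∀ n → attempt n 0 ≢ 0 → ∀ m → m ≤ n → attempt n m ≢ 0 → c A m ≤ c A (best n)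
  best-max n a₀≢0 m m≤n a≢0 = subst (λ b → c A m ≤ c A b) (sym best≡ms)
    (s≤s⁻¹ (subst₂ _≤_ (attempt-≢0 a≢0) (attempt-≢0 ams≢0) (max m m≤n)))
    where
    maximiser = maximum-attained (attempt n) n
    ms = proj₁ maximiser
    ms≤n = proj₁ (proj₂ maximiser)
    max = proj₂ (proj₂ maximiser)
    ams≢0 : attempt n ms ≢ 0
    ams≢0 ams≡0 = a₀≢0 (n≤0⇒n≡0 (subst (attempt n 0 ≤_) ams≡0 (max 0 z≤n)))
    isBest-ms : isBest n ms ≡ 1
    isBest-ms = cong₂ _*_ (χ≤-≤ (n≢0⇒n>0 ams≢0))
                          (∏<-ones (suc n) (λ m′ m′<1+n → χ≤-≤ (max m′ (s≤s⁻¹ m′<1+n))))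
    unique : ∀ m → m < suc n → isBest n m ≢ 0 → m ≡ ms
    unique m m<1+n isBest≢0 = c-injective A (suc-injective (begin
      suc (c A m)   ≡⟨ sym (attempt-≢0 am≢0) ⟩
      attempt n m   ≡⟨ ≤-antisym (max m (s≤s⁻¹ m<1+n))
                                 (χ≤≢0⇒≤ _ _ (∏<-≢0 (suc n) (proj₂ factors) ms (s≤s ms≤n))) ⟩
      attempt n ms  ≡⟨ attempt-≢0 ams≢0 ⟩
      suc (c A ms)  ∎))
      where
      open ≡-Reasoning
      factors = *-≢0 (sg (attempt n m)) _ isBest≢0
      am≢0 : attempt n m ≢ 0
      am≢0 am≡0 = proj₁ factors (cong sg am≡0)
    best≡ms : best n ≡ ms
    best≡ms = mean≡constOnSupport (isBest n) (λ m → m) ms (suc n) unique ms (s≤s ms≤n)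
      (λ isBest≡0 → 0≢1+n (trans (sym isBest≡0) isBest-ms))

  succeeding⇒≤ : ∀ n m → m ≤ suc n → (∀ m′ → m′ < m → attempt n m′ ≢ 0) →
                 m ≤ suc (c A (best n))
  succeeding⇒≤ n zero    _       _       = z≤n
  succeeding⇒≤ n (suc m) m<1+n succeeds = injective⇒≤ (c-injective A) (suc m) (c A (best n))
    (λ m′ m′<1+m → best-max n (succeeds 0 z<s) m′ (≤-trans (s≤s⁻¹ m′<1+m) (s≤s⁻¹ m<1+n))
                             (succeeds m′ m′<1+m))

  clockBoundSum : ℕ → ℕ
  clockBoundSum = ∑< (λ j → clockBound pc (j ∷ []))

  succeeding⊎belowClock : ∀ n m → m ≤ suc n →
    (∀ m′ → m′ < m → attempt n m′ ≢ 0) ⊎ n < clockBoundSum (2 + c A (best n))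
  succeeding⊎belowClock n zero    _        = inj₁ (λ _ ())
  succeeding⊎belowClock n (suc m) m<1+n with succeeding⊎belowClock n m (<⇒≤ m<1+n)
  ... | inj₂ n<clockBoundSum = inj₂ n<clockBoundSum
  ... | inj₁ succeeds with attempt n m ≟ 0
  ...   | no  am≢0 = inj₁ λ m′ m′<1+m →
    [ succeeds m′ , (λ { refl → am≢0 }) ]′ (m≤n⇒m<n∨m≡n (s≤s⁻¹ m′<1+m))
  ...   | yes am≡0 = inj₂
    (<-≤-trans n<clockBound (term≤∑< _ m (s≤s (succeeding⇒≤ n m (<⇒≤ m<1+n) succeeds))))
    where
    n<clockBound : n < clockBound pc (m ∷ [])
    n<clockBound = ≰⇒> λ clock≤n → 0≢1+n (trans (sym am≡0) (attempt-correct clock≤n))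

  c⁻¹-bound : ∀ n → n ≤ c A (best n) + clockBoundSum (2 + c A (best n))
  c⁻¹-bound n with succeeding⊎belowClock n (suc n) ≤-refl
  ... | inj₁ succeeds   = ≤-trans (s≤s⁻¹ (succeeding⇒≤ n (suc n) ≤-refl succeeds)) (m≤m+n (c A (best n)) _)
  ... | inj₂ n<clockBoundSum = ≤-trans (<⇒≤ n<clockBoundSum) (m≤n+m _ (c A (best n)))

  c⁻¹-primRec : IsPrimRec {1} (λ xs → c⁻¹ A (head xs))
  c⁻¹-primRec = inverse-closed (c∘c⁻¹ A) (c⁻¹∘c A) (c⁻¹-bound ∘ c⁻¹ A) Pc
    (+-closed Pbest (∑-closed {f = λ ys → clockBound pc (head ys ∷ [])} Pclock (suc-closed (suc-closed Pbest))))
    where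
    open P
    Pbest : IsPrimRec {1} (λ xs → c A (best (c⁻¹ A (head xs))))
    Pbest = ext (λ { (x ∷ []) → refl }) (elementaryOn best-elementary)
    Pclock : IsPrimRec {2} (λ ys → clockBound pc (head ys ∷ []))
    Pclock = ∘-closed {σ = λ ys → head ys ∷ []} (clockBound-primRec pc) (∷-map head-closed []-map)

mainTheorem9 : (B : FinFunSet) → IsSubstBasisElem B → BasisForPunctualStandardness B
mainTheorem9 B (_ , obtainable) A B-on = punctuallyStandard A Pc (Inversion.c⁻¹-primRec A Pc elementaryOn)
  where
  elementaryOn : ∀ {k} {f : Fun k} → IsElementary f → PrimRecOn A f
  elementaryOn {k} {f} Ef = obtainable-primRecOn A B-on (obtainable k f Ef)
  Pc : IsPrimRec {1} (λ xs → c A (head xs))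
  Pc = c-primRec A (sA-primRec A (elementaryOn E.suc-closed₁))
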